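{- Let $X$ be a finite set, let $\ell\geq 1$ be an integer, and let $\mathcal{F}\subset 2^X$ be a weakly-$k$-cross-free family such that $|A|=\ell$ for every $A\in\mathcal{F}$. Then $|\mathcal{F}|\leq (k-1)|X|/\ell$.
   Context: Two sets $A,B\subset X$ are weakly-crossing if none of the three sets $A\cap B$, $A\setminus B$, $B\setminus A$ is empty. A family is weakly-$k$-cross-free if it does not contain $k$ pairwise weakly-crossing members. -}

module Defs where

open import Data.Nat using (ℕ)
open import Data.Fin using (Fin)
open import Data.Fin.Subset using (Subset; _∩_; _─_; Nonempty)
open import Data.Product using (_×_; Σ)
open import Data.List using (List)
open import Data.List.Membership.Propositional using (_∈_)
open import Relation.Binary.PropositionalEquality using (_≡_; _≢_)
open import Relation.Nullary using (¬_)

-- Ground set X is Fin n; subsets of X are Subset n (bit vectors).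
-- A and B are weakly-crossing: A ∩ B, A ∖ B, B ∖ A all nonempty.
WeaklyCrossing : {n : ℕ} → Subset n → Subset n → Set
WeaklyCrossing A B = Nonempty (A ∩ B) × Nonempty (A ─ B) × Nonempty (B ─ A)

-- 𝓕 (a duplicate-free list of subsets) contains k pairwise weakly-crossing
-- members: k distinct members of 𝓕, any two distinct of which weakly cross.
HasKPairwiseCrossing : {n : ℕ} → ℕ → List (Subset n) → Set
HasKPairwiseCrossing {n} k 𝓕 =
  Σ (Fin k → Subset n) λ f →
    ((i : Fin k) → f i ∈ 𝓕) ×
    ((i j : Fin k) → i ≢ j → WeaklyCrossing (f i) (f j))

WeaklyKCrossFree : {n : ℕ} → ℕ → List (Subset n) → Set
WeaklyKCrossFree k 𝓕 = ¬ HasKPairwiseCrossing k 𝓕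

-- Distinct sets of the same size meeting in a point x
-- weakly cross, since neither can contain the other; so every x lies in at
-- most k − 1 members of 𝓕.  Counting incidences by members and by points,
-- ℓ ∣𝓕∣ = Σ_A ∣A∣ = Σ_x deg x ≤ (k − 1) ∣X∣.
module Submission where

open import Defs
open import Data.Empty using (⊥-elim)
open import Data.Fin using (Fin; zero; suc; inject≤)
open import Data.Fin.Properties using (inject≤-injective)
open import Data.Fin.Subset using (Subset; ∣_∣; _∈_; _─_; Nonempty; inside; outside)
open import Data.Fin.Subset.Properties using (_∈?_; x∈p∩q⁺)
open import Data.List using (List; []; _∷_; length; lookup; filter; map)
open import Data.List.Membership.Propositional.Properties using (∈-lookup; ∈-filter⁻)
open import Data.List.Membership.Propositional using () renaming (_∈_ to _∈ˡ_)
open import Data.List.Relation.Unary.All as All using (All; []; _∷_)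
open import Data.List.Relation.Unary.AllPairs using (_∷_)
open import Data.List.Relation.Unary.Unique.Propositional using (Unique)
open import Data.List.Relation.Unary.Unique.Propositional.Properties using (filter⁺)
open import Data.Nat using (ℕ; zero; suc; _+_; _*_; _∸_; _≤_; s≤s; _≤?_)
open import Data.Nat.ListAction using (sum)
open import Data.Nat.Properties
  using (≤-trans; ≤-reflexive; n≤1+n; <-irrefl; +-mono-≤; *-suc; *-zeroʳ; ≰⇒>; <⇒≤pred;
         +-commutativeSemigroup; module ≤-Reasoning)
open import Algebra.Properties.CommutativeSemigroup +-commutativeSemigroup using (x∙yz≈y∙xz)
open import Data.Product using (Σ; _,_; _×_; proj₁; proj₂)
open import Data.Vec using ([]; _∷_; tail; here; there)
open import Function using (Injective; _∘_)
open import Level using (Level)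
open import Relation.Nullary using (yes; no)
open import Relation.Binary.PropositionalEquality
  using (_≡_; _≢_; refl; sym; cong; cong₂; trans)

private
  variable
    a : Level
    n : ℕ

module _ {A : Set a} where

  Unique⇒lookup-injective : {xs : List A} → Unique xs → Injective _≡_ _≡_ (lookup xs)
  Unique⇒lookup-injective {_ ∷ _} _           {zero}  {zero}  _  = refl
  Unique⇒lookup-injective {_ ∷ _} (x∉xs ∷ _) {zero}  {suc j} eq = ⊥-elim (All.lookup x∉xs (∈-lookup j) eq)
  Unique⇒lookup-injective {_ ∷ _} (x∉xs ∷ _) {suc i} {zero}  eq = ⊥-elim (All.lookup x∉xs (∈-lookup i) (sym eq))
  Unique⇒lookup-injective {_ ∷ _} (_ ∷ uniq) {suc i} {suc j} eq = cong suc (Unique⇒lookup-injective uniq eq)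

  Unique⇒distinct-members : {xs : List A} (k : ℕ) → Unique xs → k ≤ length xs →
    Σ (Fin k → A) λ f → ((i : Fin k) → f i ∈ˡ xs) × ((i j : Fin k) → i ≢ j → f i ≢ f j)
  Unique⇒distinct-members {xs} k uniq k≤∣xs∣ =
    member , (λ i → ∈-lookup (inject≤ i k≤∣xs∣)) ,
    λ i j i≢j eq → i≢j (inject≤-injective k≤∣xs∣ k≤∣xs∣ i j (Unique⇒lookup-injective uniq eq))
    where
    member : Fin k → A
    member i = lookup xs (inject≤ i k≤∣xs∣)

Nonempty[p─q]⇒Nonempty[sp─tq] : ∀ s t {p q : Subset n} →
  Nonempty (p ─ q) → Nonempty ((s ∷ p) ─ (t ∷ q))
Nonempty[p─q]⇒Nonempty[sp─tq] _ _ (x , x∈p─q) = suc x , there x∈p─q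

∣q∣≤∣p∣∧p≢q⇒Nonempty[p─q] : (p q : Subset n) → ∣ q ∣ ≤ ∣ p ∣ → p ≢ q → Nonempty (p ─ q)
∣q∣≤∣p∣∧p≢q⇒Nonempty[p─q] []            []            _         p≢q = ⊥-elim (p≢q refl)
∣q∣≤∣p∣∧p≢q⇒Nonempty[p─q] (inside ∷ p)  (outside ∷ q) _         _   = zero , here
∣q∣≤∣p∣∧p≢q⇒Nonempty[p─q] (inside ∷ p)  (inside ∷ q)  (s≤s q≤p) p≢q =
  Nonempty[p─q]⇒Nonempty[sp─tq] inside inside
    (∣q∣≤∣p∣∧p≢q⇒Nonempty[p─q] p q q≤p (p≢q ∘ cong (inside ∷_)))
∣q∣≤∣p∣∧p≢q⇒Nonempty[p─q] (outside ∷ p) (outside ∷ q) q≤p       p≢q =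
  Nonempty[p─q]⇒Nonempty[sp─tq] outside outside
    (∣q∣≤∣p∣∧p≢q⇒Nonempty[p─q] p q q≤p (p≢q ∘ cong (outside ∷_)))
∣q∣≤∣p∣∧p≢q⇒Nonempty[p─q] (outside ∷ p) (inside ∷ q)  q<p       _   =
  Nonempty[p─q]⇒Nonempty[sp─tq] outside inside
    (∣q∣≤∣p∣∧p≢q⇒Nonempty[p─q] p q (≤-trans (n≤1+n _) q<p) p≢q)
  where
  p≢q : p ≢ q
  p≢q refl = <-irrefl refl q<p

sameSize∧∩∧≢⇒WeaklyCrossing : ∀ {x} {p q : Subset n} → x ∈ p → x ∈ q → ∣ p ∣ ≡ ∣ q ∣ → p ≢ q →
  WeaklyCrossing p q
sameSize∧∩∧≢⇒WeaklyCrossing {x = x} {p} {q} x∈p x∈q ∣p∣≡∣q∣ p≢q =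
  (x , x∈p∩q⁺ (x∈p , x∈q)) ,
  ∣q∣≤∣p∣∧p≢q⇒Nonempty[p─q] p q (≤-reflexive (sym ∣p∣≡∣q∣)) p≢q ,
  ∣q∣≤∣p∣∧p≢q⇒Nonempty[p─q] q p (≤-reflexive ∣p∣≡∣q∣) (p≢q ∘ sym)

degree : Fin n → List (Subset n) → ℕ
degree x 𝓕 = length (filter (x ∈?_) 𝓕)

degree≤k∸1 : ∀ {k ℓ} (𝓕 : List (Subset n)) → Unique 𝓕 → WeaklyKCrossFree k 𝓕 →
  All (λ A → ∣ A ∣ ≡ ℓ) 𝓕 → (x : Fin n) → degree x 𝓕 ≤ k ∸ 1
degree≤k∸1 {k = k} 𝓕 uniq crossFree sizes x with k ≤? degree x 𝓕
... | no  k≰deg = <⇒≤pred (≰⇒> k≰deg)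
... | yes k≤deg with Unique⇒distinct-members k (filter⁺ (x ∈?_) uniq) k≤deg
...   | f , f∈star , f-injective = ⊥-elim (crossFree (f , f∈𝓕 , crossing))
  where
  f∈𝓕 : (i : Fin k) → f i ∈ˡ 𝓕
  f∈𝓕 i = proj₁ (∈-filter⁻ (x ∈?_) {xs = 𝓕} (f∈star i))
  x∈f : (i : Fin k) → x ∈ f i
  x∈f i = proj₂ (∈-filter⁻ (x ∈?_) {xs = 𝓕} (f∈star i))
  crossing : (i j : Fin k) → i ≢ j → WeaklyCrossing (f i) (f j)
  crossing i j i≢j = sameSize∧∩∧≢⇒WeaklyCrossing (x∈f i) (x∈f j)
    (trans (All.lookup sizes (f∈𝓕 i)) (sym (All.lookup sizes (f∈𝓕 j))))
    (f-injective i j i≢j)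

totalSize : List (Subset n) → ℕ
totalSize 𝓕 = sum (map ∣_∣ 𝓕)

totalSize[Subset0]≡0 : (𝓕 : List (Subset 0)) → totalSize 𝓕 ≡ 0
totalSize[Subset0]≡0 []        = refl
totalSize[Subset0]≡0 ([] ∷ 𝓕) = totalSize[Subset0]≡0 𝓕

totalSize-by-first-column : (𝓕 : List (Subset (suc n))) →
  totalSize 𝓕 ≡ degree zero 𝓕 + totalSize (map tail 𝓕)
remaining-rows : (A : Subset n) (𝓕 : List (Subset (suc n))) →
  ∣ A ∣ + totalSize 𝓕 ≡ degree zero 𝓕 + (∣ A ∣ + totalSize (map tail 𝓕))

totalSize-by-first-column []                   = refl
totalSize-by-first-column ((inside ∷ A) ∷ 𝓕)  = cong suc (remaining-rows A 𝓕)
totalSize-by-first-column ((outside ∷ A) ∷ 𝓕) = remaining-rows A 𝓕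

remaining-rows A 𝓕 = trans (cong (∣ A ∣ +_) (totalSize-by-first-column 𝓕))
                           (x∙yz≈y∙xz ∣ A ∣ (degree zero 𝓕) (totalSize (map tail 𝓕)))

degree-suc : (x : Fin n) (𝓕 : List (Subset (suc n))) → degree (suc x) 𝓕 ≡ degree x (map tail 𝓕)
degree-suc x [] = refl
degree-suc x ((_ ∷ A) ∷ 𝓕) with x ∈? A
... | yes _ = cong suc (degree-suc x 𝓕)
... | no  _ = degree-suc x 𝓕

totalSize≤degreeBound*n : ∀ m (𝓕 : List (Subset n)) → ((x : Fin n) → degree x 𝓕 ≤ m) →
  totalSize 𝓕 ≤ m * n
totalSize≤degreeBound*n {zero} m 𝓕 _ = ≤-reflexive (trans (totalSize[Subset0]≡0 𝓕) (sym (*-zeroʳ m)))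
totalSize≤degreeBound*n {suc n} m 𝓕 deg≤m = begin
  totalSize 𝓕                                ≡⟨ totalSize-by-first-column 𝓕 ⟩
  degree zero 𝓕 + totalSize (map tail 𝓕)    ≤⟨ +-mono-≤ (deg≤m zero) (totalSize≤degreeBound*n m (map tail 𝓕) deg≤m′) ⟩
  m + m * n                                  ≡⟨ *-suc m n ⟨
  m * suc n                                  ∎
  where
  open ≤-Reasoning
  deg≤m′ : (x : Fin n) → degree x (map tail 𝓕) ≤ m
  deg≤m′ x = ≤-trans (≤-reflexive (sym (degree-suc x 𝓕))) (deg≤m (suc x))

totalSize-uniform : ∀ ℓ (𝓕 : List (Subset n)) → All (λ A → ∣ A ∣ ≡ ℓ) 𝓕 → totalSize 𝓕 ≡ ℓ * length 𝓕
totalSize-uniform ℓ []       []            = sym (*-zeroʳ ℓ)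
totalSize-uniform ℓ (A ∷ 𝓕) (∣A∣≡ℓ ∷ sizes) =
  trans (cong₂ _+_ ∣A∣≡ℓ (totalSize-uniform ℓ 𝓕 sizes)) (sym (*-suc ℓ (length 𝓕)))

lemma2p3 : (n k ℓ : ℕ) → 1 ≤ ℓ → (𝓕 : List (Subset n)) → Unique 𝓕 →
    WeaklyKCrossFree k 𝓕 → All (λ A → ∣ A ∣ ≡ ℓ) 𝓕 →
    ℓ * length 𝓕 ≤ (k ∸ 1) * n
lemma2p3 n k ℓ _ 𝓕 uniq crossFree sizes = begin
  ℓ * length 𝓕  ≡⟨ totalSize-uniform ℓ 𝓕 sizes ⟨
  totalSize 𝓕   ≤⟨ totalSize≤degreeBound*n (k ∸ 1) 𝓕 (degree≤k∸1 𝓕 uniq crossFree sizes) ⟩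
  (k ∸ 1) * n   ∎
  where open ≤-Reasoning
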